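{- Let $d$ be a dyadic rational such that $0\le d<1$. (1) If $m$ is a positive integer, then $\{d\mid\,\}:m=m+1$. (2) If $m$ is a negative integer, then $\{0\mid\,\}:m=2^m$. (3) If $m$ is a negative integer and $d\neq0$ has binary expansion $d=\sum_{i\ge1}d_i2^{ -i}$, then $\{d\mid\,\}:m=\sum_{i=1}^{j-1}d_i2^{ -i}+2^{ -j}$ (binary $0.d_1d_2\ldots d_{j-1}1$), where $j$ is the index of the $|m|$-th zero digit of the binary expansion of $d$.
   Context: Short partizan games under normal play. For game forms $G,H$ the ordinal sum is $G:H=\{G^{\mathcal L},G:H^{\mathcal L}\,|\,G^{\mathcal R},G:H^{\mathcal R}\}$, using the options of the literal form of the base $G$ and of the subordinate $H$. $\{x\mid\,\}$ denotes the game with single Left option $x$ and no Right option (used literally as the base). Binary expansions are infinite digit sequences with $0$-digits after the last $1$-digit. Equalities are equalities of game values. -}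

module Defs where

open import Data.Nat as ℕ using (ℕ; zero; suc; _+_; _*_; _^_; _∸_; _/_; _%_)
open import Data.Fin using (Fin; splitAt)
open import Data.Sum using ([_,_]′)
open import Data.Product using (_×_)
open import Data.Integer as ℤ using (ℤ; +_; -[1+_])
open import Relation.Nullary using (¬_)
open import Relation.Binary.PropositionalEquality using (_≡_)

data Game : Set where
  mk : (nl : ℕ) → (Fin nl → Game) → (nr : ℕ) → (Fin nr → Game) → Game

zeroG : Game
zeroG = mk 0 (λ ()) 0 (λ ())

leftOnly : Game → Game
leftOnly x = mk 1 (λ _ → x) 0 (λ ())

_≤G_ : Game → Game → Set
mk nl gL nr gR ≤G mk ml hL mr hR =
  ((i : Fin nl) → ¬ (mk ml hL mr hR ≤G gL i)) ×
  ((j : Fin mr) → ¬ (hR j ≤G mk nl gL nr gR))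

_≈G_ : Game → Game → Set
G ≈G H = (G ≤G H) × (H ≤G G)

infix 4 _≤G_ _≈G_

_+G_ : Game → Game → Game
mk nl gL nr gR +G mk ml hL mr hR =
  mk (nl + ml)
     (λ x → [ (λ i → gL i +G mk ml hL mr hR) , (λ i → mk nl gL nr gR +G hL i) ]′ (splitAt nl x))
     (nr + mr)
     (λ x → [ (λ i → gR i +G mk ml hL mr hR) , (λ i → mk nl gL nr gR +G hR i) ]′ (splitAt nr x))

infixl 6 _+G_

-- ordinal sum G : H = {G^L, G:H^L | G^R, G:H^R}  (options of the literal form of G)
_∶G_ : Game → Game → Game
mk nl gL nr gR ∶G mk ml hL mr hR =
  mk (nl + ml)
     (λ x → [ gL , (λ i → mk nl gL nr gR ∶G hL i) ]′ (splitAt nl x))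
     (nr + mr)
     (λ x → [ gR , (λ i → mk nl gL nr gR ∶G hR i) ]′ (splitAt nr x))

natG : ℕ → Game
natG zero    = zeroG
natG (suc n) = mk 1 (λ _ → natG n) 0 (λ ())

negG : ℕ → Game
negG zero    = zeroG
negG (suc n) = mk 0 (λ ()) 1 (λ _ → negG n)

intG : ℤ → Game
intG (+ n)      = natG n
intG -[1+ n ]   = negG (suc n)

pow2neg : ℕ → Game
pow2neg zero    = mk 1 (λ _ → zeroG) 0 (λ ())
pow2neg (suc k) = mk 1 (λ _ → zeroG) 1 (λ _ → pow2neg k)

natMulG : ℕ → Game → Game
natMulG zero    g = zeroG
natMulG (suc n) g = g +G natMulG n g

dyadicG : ℕ → ℕ → Game
dyadicG a k = natMulG a (pow2neg k)

shiftR : ℕ → ℕ → ℕ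
shiftR x zero    = x
shiftR x (suc b) = shiftR (x / 2) b

-- i-th binary digit (i ≥ 1) of d = a / 2^k, i.e. ⌊d · 2^i⌋ mod 2
digit : ℕ → ℕ → ℕ → ℕ
digit a k i = shiftR (a * 2 ^ i) k % 2

zeroCount : ℕ → ℕ → ℕ → ℕ
zeroCount a k zero    = 0
zeroCount a k (suc j) with digit a k (suc j)
... | zero  = suc (zeroCount a k j)
... | suc _ = zeroCount a k j

IsNthZeroIndex : ℕ → ℕ → ℕ → ℕ → Set
IsNthZeroIndex a k r j = (1 ℕ.≤ j) × (digit a k j ≡ 0) × (zeroCount a k j ≡ r)

prefixG : ℕ → ℕ → ℕ → Game
prefixG a k zero    = zeroG
prefixG a k (suc i) = prefixG a k i +G natMulG (digit a k (suc i)) (pow2neg (suc i))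

-- Every game that occurs is certified, hereditarily, to equal a dyadic number V/2^N by the
-- simplicity theorem: the values of its left and right options lie below and above V, V/2^N
-- lies on the grid of mesh 2^(t-N), and some left option (and, unless t = N, some right option)
-- lies within one mesh of it, so no simpler number fits between the options. Certified games
-- compare as their numerators do, and each identity becomes arithmetic on numerators.
-- For {d|}:n the left options are d and (inductively) n, which gives n + 1. For {d|}:(-c) one
-- reads the binary digits of d. With T_i = ⌊2^i d⌋ and c_i the number of zeros among d_1 … d_i,
-- the game {d|}:(-c_i) has value (T_i + 1)/2^i: a digit 1 changes neither the game nor this
-- value, and a digit 0 makes the previous game the new right option, the simplest number between
-- d and it being (2 T_(i-1) + 1)/2^i. At the |m|-th zero digit j this is 0.d_1 … d_(j-1) 1.
module Submission where

open import Defs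
open import Data.Nat using (ℕ; zero; suc; _<_; _^_; _∸_)
open import Data.Product using (_×_; _,_)
open import Relation.Binary.PropositionalEquality
  using (_≢_; _≡_; refl; sym; trans; cong; subst; subst₂; module ≡-Reasoning)

module DyadicValues where

  open import Data.Nat using (_+_; _*_; _≤_; _≤?_; _≟_; z≤n; s≤s; s<s⁻¹; NonZero; _/_)
  open import Data.Nat.Properties
  open import Data.Nat.DivMod
    using (m≡m%n+[m/n]*n; m%n<n; m/n*n≤m; m<n⇒m/n≡0; m/n/o≡m/[n*o]; m*n/n≡m; n/1≡n)
  open import Data.Nat.Divisibility
    using (_∣_; divides-refl; ∣-refl; ∣-trans; _∣0; 1∣_; ∣m∣n⇒∣m+n; *-monoʳ-∣; n∣m*n)
  open import Data.Nat.Tactic.RingSolver using (solve-∀)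
  open import Data.Fin using (Fin; zero; suc; _↑ˡ_; _↑ʳ_)
  import Data.Product as Σ
  open import Data.Sum using (_⊎_; inj₁; inj₂; [_,_]′)
  open import Data.Empty using (⊥-elim)
  open import Function using (_∘_)
  open import Relation.Nullary using (yes; no)
  open import Data.Vec.Functional using (Vector; map; _++_)
  open import Data.Vec.Functional.Properties using (lookup-++ˡ; lookup-++ʳ)
  open import Data.Vec.Functional.Relation.Unary.All using (All)
  import Data.Vec.Functional.Relation.Unary.All.Properties as All
  open import Data.Vec.Functional.Relation.Unary.Any using (Any)
  open import Data.Vec.Functional.Relation.Binary.Pointwise using (Pointwise)
  import Data.Vec.Functional.Relation.Binary.Pointwise.Properties as Pointwise

  ∣-<⇒+≤ : ∀ {d m n} → d ∣ m → d ∣ n → n < m → n + d ≤ m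
  ∣-<⇒+≤ {d} (divides-refl p) (divides-refl q) n<m =
    subst (_≤ p * d) (+-comm d (q * d)) (*-monoˡ-≤ d (*-cancelʳ-< d q p n<m))

  ^-monoʳ-∣ : ∀ m {a b} → a ≤ b → m ^ a ∣ m ^ b
  ^-monoʳ-∣ m {b = b} z≤n = 1∣ (m ^ b)
  ^-monoʳ-∣ m (s≤s a≤b)   = *-monoʳ-∣ m (^-monoʳ-∣ m a≤b)

  -- Represents N G V certifies G = V/2^N. The grain t says that V/2^N is a multiple of
  -- 2^(t-N) lying within 2^(t-N) of a left option (if V > 0) and of a right option (if t < N).
  record Grain (N V : ℕ) {nl nr : ℕ} (vl : Vector ℕ nl) (vr : Vector ℕ nr) : Set where
    field
      grain      : ℕ
      grain≤N    : grain ≤ N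
      grain∣V    : 2 ^ grain ∣ V
      near-left  : 0 < V → Any (λ v → V ≤ v + 2 ^ grain) vl
      near-right : grain < N → Any (λ v → v ≤ V + 2 ^ grain) vr

  record Simplest (N V : ℕ) {nl nr : ℕ} (vl : Vector ℕ nl) (vr : Vector ℕ nr) : Set where
    field
      below   : All (_< V) vl
      above   : All (V <_) vr
      grained : Grain N V vl vr

  data Represents (N : ℕ) : Game → ℕ → Set where
    num : ∀ {nl nr gL gR V} {vl : Vector ℕ nl} {vr : Vector ℕ nr} →
          Pointwise (Represents N) gL vl → Pointwise (Represents N) gR vr →
          Simplest N V vl vr → Represents N (mk nl gL nr gR) V

  open Grain
  open Simplest

  -- The finer-grained side supplies the witness: the other value lies on its grid, hence a mesh away.
  crossing : ∀ {N V W nl nr ml mr}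
               {vl : Vector ℕ nl} {vr : Vector ℕ nr} {wl : Vector ℕ ml} {wr : Vector ℕ mr} →
             Grain N V vl vr → Grain N W wl wr → W < V → Any (W ≤_) vl ⊎ Any (_≤ V) wr
  crossing {V = V} {W} g h W<V with grain g ≤? grain h
  ... | yes g≤h = let (i , V≤vᵢ+2^t) = near-left g (≤-<-trans z≤n W<V) in
    inj₁ (i , +-cancelʳ-≤ (2 ^ grain g) W _
      (≤-trans (∣-<⇒+≤ (grain∣V g) (∣-trans (^-monoʳ-∣ 2 g≤h) (grain∣V h)) W<V) V≤vᵢ+2^t))
  ... | no g≰h = let (j , wⱼ≤W+2^t) = near-right h (<-≤-trans (≰⇒> g≰h) (grain≤N g)) in
    inj₂ (j , ≤-trans wⱼ≤W+2^t
      (∣-<⇒+≤ (∣-trans (^-monoʳ-∣ 2 (<⇒≤ (≰⇒> g≰h))) (grain∣V g)) (grain∣V h) W<V))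

  module _ {N : ℕ} where

    ≤⇒≤G : ∀ {G H V W} → Represents N G V → Represents N H W → V ≤ W → G ≤G H
    ≤G⇒≤ : ∀ {G H V W} → Represents N G V → Represents N H W → G ≤G H → V ≤ W

    ≤⇒≤G g@(num gᴸ _ sG) h@(num _ hᴿ sH) V≤W =
      (λ i H≤Gᴸ → <⇒≱ (<-≤-trans (below sG i) V≤W) (≤G⇒≤ h (gᴸ i) H≤Gᴸ)) ,
      (λ j Hᴿ≤G → <⇒≱ (≤-<-trans V≤W (above sH j)) (≤G⇒≤ (hᴿ j) g Hᴿ≤G))

    ≤G⇒≤ g@(num gᴸ _ sG) h@(num _ hᴿ sH) (no-Gᴸ , no-Hᴿ) = ≮⇒≥ λ W<V →
      [ (λ (i , W≤vᵢ) → no-Gᴸ i (≤⇒≤G h (gᴸ i) W≤vᵢ))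
      , (λ (j , wⱼ≤V) → no-Hᴿ j (≤⇒≤G (hᴿ j) g wⱼ≤V)) ]′
      (crossing (grained sG) (grained sH) W<V)

    ≡⇒≈G : ∀ {G H V W} → Represents N G V → Represents N H W → V ≡ W → G ≈G H
    ≡⇒≈G g h refl = ≤⇒≤G g h ≤-refl , ≤⇒≤G h g ≤-refl

  any-++ˡ : ∀ (P : ℕ → Set) {m n} {xs : Vector ℕ m} {ys : Vector ℕ n} → Any P xs → Any P (xs ++ ys)
  any-++ˡ P {xs = xs} {ys} (i , p) = i ↑ˡ _ , subst P (sym (lookup-++ˡ xs ys i)) p

  any-++ʳ : ∀ (P : ℕ → Set) {m n} {xs : Vector ℕ m} {ys : Vector ℕ n} → Any P ys → Any P (xs ++ ys)
  any-++ʳ P {xs = xs} {ys} (i , p) = _ ↑ʳ i , subst P (sym (lookup-++ʳ xs ys i)) p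

  +-shiftʳ-≤ : ∀ c t {x y} → x ≤ y + t → x + c ≤ y + c + t
  +-shiftʳ-≤ c t {x} {y} x≤y+t = subst (x + c ≤_) (+-comm-last y t c) (+-monoˡ-≤ c x≤y+t)
    where
    +-comm-last : ∀ y t c → y + t + c ≡ y + c + t
    +-comm-last = solve-∀

  +-shiftˡ-≤ : ∀ c t {x y} → x ≤ y + t → c + x ≤ c + y + t
  +-shiftˡ-≤ c t {x} {y} x≤y+t = subst (c + x ≤_) (sym (+-assoc c y t)) (+-monoʳ-≤ c x≤y+t)

  module _ {N V W nl nr ml mr : ℕ}
           {vl : Vector ℕ nl} {vr : Vector ℕ nr} {wl : Vector ℕ ml} {wr : Vector ℕ mr} where

    grain-+ʳ : (g : Grain N V vl vr) → 2 ^ grain g ∣ W → (0 < V + W → 0 < V) →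
               Grain N (V + W) (map (_+ W) vl ++ map (V +_) wl) (map (_+ W) vr ++ map (V +_) wr)
    grain-+ʳ g 2^t∣W positive = record
      { grain      = grain g
      ; grain≤N    = grain≤N g
      ; grain∣V    = ∣m∣n⇒∣m+n (grain∣V g) 2^t∣W
      ; near-left  = λ V+W>0 → any-++ˡ (λ v → V + W ≤ v + 2 ^ grain g)
                                 (Σ.map₂ (+-shiftʳ-≤ W (2 ^ grain g)) (near-left g (positive V+W>0)))
      ; near-right = λ t<N → any-++ˡ (λ v → v ≤ V + W + 2 ^ grain g)
                                 (Σ.map₂ (+-shiftʳ-≤ W (2 ^ grain g)) (near-right g t<N))
      }

    grain-+ˡ : (h : Grain N W wl wr) → 2 ^ grain h ∣ V → (0 < V + W → 0 < W) →
               Grain N (V + W) (map (_+ W) vl ++ map (V +_) wl) (map (_+ W) vr ++ map (V +_) wr)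
    grain-+ˡ h 2^t∣V positive = record
      { grain      = grain h
      ; grain≤N    = grain≤N h
      ; grain∣V    = ∣m∣n⇒∣m+n 2^t∣V (grain∣V h)
      ; near-left  = λ V+W>0 → any-++ʳ (λ v → V + W ≤ v + 2 ^ grain h)
                                 (Σ.map₂ (+-shiftˡ-≤ V (2 ^ grain h)) (near-left h (positive V+W>0)))
      ; near-right = λ t<N → any-++ʳ (λ v → v ≤ V + W + 2 ^ grain h)
                                 (Σ.map₂ (+-shiftˡ-≤ V (2 ^ grain h)) (near-right h t<N))
      }

    grain-+ : Grain N V vl vr → Grain N W wl wr →
              Grain N (V + W) (map (_+ W) vl ++ map (V +_) wl) (map (_+ W) vr ++ map (V +_) wr)
    grain-+ g h with V ≟ 0 | W ≟ 0
    ... | yes refl | _        = grain-+ˡ h (_ ∣0) λ W>0 → W>0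
    ... | no V≢0   | yes refl = grain-+ʳ g (_ ∣0) λ _ → n≢0⇒n>0 V≢0
    ... | no V≢0   | no W≢0 with grain g ≤? grain h
    ...   | yes g≤h = grain-+ʳ g (∣-trans (^-monoʳ-∣ 2 g≤h) (grain∣V h)) λ _ → n≢0⇒n>0 V≢0
    ...   | no g≰h  =
      grain-+ˡ h (∣-trans (^-monoʳ-∣ 2 (<⇒≤ (≰⇒> g≰h))) (grain∣V g)) λ _ → n≢0⇒n>0 W≢0

    simplest-+ : Simplest N V vl vr → Simplest N W wl wr →
                 Simplest N (V + W) (map (_+ W) vl ++ map (V +_) wl) (map (_+ W) vr ++ map (V +_) wr)
    simplest-+ s r = record
      { below   = All.++⁺ (_< V + W) (λ i → +-monoˡ-< W (below s i)) (λ i → +-monoʳ-< V (below r i))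
      ; above   = All.++⁺ (V + W <_) (λ i → +-monoˡ-< W (above s i)) (λ i → +-monoʳ-< V (above r i))
      ; grained = grain-+ (grained s) (grained r)
      }

  represents-+ : ∀ {N G H V W} → Represents N G V → Represents N H W → Represents N (G +G H) (V + W)
  represents-+ g@(num gᴸ gᴿ s) h@(num hᴸ hᴿ r) =
    num (Pointwise.++⁺ (Represents _) (λ i → represents-+ (gᴸ i) h) (λ i → represents-+ g (hᴸ i)))
        (Pointwise.++⁺ (Represents _) (λ i → represents-+ (gᴿ i) h) (λ i → represents-+ g (hᴿ i)))
        (simplest-+ s r)

  simplest-double : ∀ {N V nl nr} {vl : Vector ℕ nl} {vr : Vector ℕ nr} →
                    Simplest N V vl vr → Simplest (suc N) (2 * V) (map (2 *_) vl) (map (2 *_) vr)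
  simplest-double {V = V} s = record
    { below   = *-monoʳ-< 2 ∘ below s
    ; above   = *-monoʳ-< 2 ∘ above s
    ; grained = record
      { grain      = suc (grain g)
      ; grain≤N    = s≤s (grain≤N g)
      ; grain∣V    = *-monoʳ-∣ 2 (grain∣V g)
      ; near-left  = λ 2V>0 → Σ.map₂ double (near-left g (*-cancelˡ-< 2 0 V 2V>0))
      ; near-right = λ t<N → Σ.map₂ double (near-right g (s<s⁻¹ t<N))
      }
    }
    where
    g = grained s
    double : ∀ {x y} → x ≤ y + 2 ^ grain g → 2 * x ≤ 2 * y + 2 ^ suc (grain g)
    double {x} {y} x≤y+t = subst (2 * x ≤_) (*-distribˡ-+ 2 y _) (*-monoʳ-≤ 2 x≤y+t)

  represents-double : ∀ {N G V} → Represents N G V → Represents (suc N) G (2 * V)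
  represents-double (num gᴸ gᴿ s) =
    num (represents-double ∘ gᴸ) (represents-double ∘ gᴿ) (simplest-double s)

  represents-rescale : ∀ e {N G V} → Represents N G V → Represents (e + N) G (V * 2 ^ e)
  represents-rescale zero    {V = V} r = subst (Represents _ _) (sym (*-identityʳ V)) r
  represents-rescale (suc e) {V = V} r =
    subst (Represents _ _) (*-comm-2 V (2 ^ e)) (represents-double (represents-rescale e r))
    where
    *-comm-2 : ∀ v b → 2 * (v * b) ≡ v * (2 * b)
    *-comm-2 = solve-∀

  simplest-leftOnly : ∀ {N V A} → A < V → 2 ^ N ∣ V → V ≤ A + 2 ^ N →
                      Simplest N V {1} {0} (λ _ → A) (λ ())
  simplest-leftOnly {N} A<V 2^N∣V V≤A+2^N = record
    { below   = λ _ → A<V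
    ; above   = λ ()
    ; grained = record
      { grain = N ; grain≤N = ≤-refl ; grain∣V = 2^N∣V
      ; near-left = λ _ → zero , V≤A+2^N ; near-right = ⊥-elim ∘ n≮n N } }

  simplest-between : ∀ {N V A B t} → A < V → V < B → t ≤ N → 2 ^ t ∣ V →
                     V ≤ A + 2 ^ t → B ≤ V + 2 ^ t →
                     Simplest N V (λ (_ : Fin 1) → A) (λ (_ : Fin 1) → B)
  simplest-between {t = t} A<V V<B t≤N 2^t∣V V≤A+2^t B≤V+2^t = record
    { below   = λ _ → A<V
    ; above   = λ _ → V<B
    ; grained = record
      { grain = t ; grain≤N = t≤N ; grain∣V = 2^t∣V
      ; near-left = λ _ → zero , V≤A+2^t ; near-right = λ _ → zero , B≤V+2^t } }

  represents-zeroG : ∀ {N} → Represents N zeroG 0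
  represents-zeroG {N} = num {vl = λ ()} {vr = λ ()} (λ ()) (λ ()) record
    { below = λ () ; above = λ ()
    ; grained = record
      { grain = N ; grain≤N = ≤-refl ; grain∣V = _ ∣0
      ; near-left = λ () ; near-right = ⊥-elim ∘ n≮n N } }

  represents-natMulG : ∀ {N G V} → Represents N G V → ∀ n → Represents N (natMulG n G) (n * V)
  represents-natMulG g zero    = represents-zeroG
  represents-natMulG g (suc n) = represents-+ g (represents-natMulG g n)

  represents-natG : ∀ {N} n → Represents N (natG n) (n * 2 ^ N)
  represents-natG zero = represents-zeroG
  represents-natG {N} (suc n) = num (λ _ → represents-natG n) (λ ())
    (simplest-leftOnly (m<n+m _ (m^n>0 2 N)) (n∣m*n (suc n)) (≤-reflexive (+-comm (2 ^ N) _)))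

  represents-pow2neg : ∀ i k → Represents (i + k) (pow2neg i) (2 ^ k)
  represents-pow2neg zero k = num (λ _ → represents-zeroG) (λ ())
    (simplest-leftOnly (m^n>0 2 k) ∣-refl ≤-refl)
  represents-pow2neg (suc i) k =
    num (λ _ → represents-zeroG) (λ _ → represents-double (represents-pow2neg i k))
      (simplest-between (m^n>0 2 k) (subst (2 ^ k <_) doubling (m<m+n _ (m^n>0 2 k))) (m≤n+m k (suc i))
        ∣-refl ≤-refl (≤-reflexive (sym doubling)))
    where
    doubling : 2 ^ k + 2 ^ k ≡ 2 * 2 ^ k
    doubling = cong (2 ^ k +_) (sym (+-identityʳ (2 ^ k)))

  represents-dyadicG : ∀ a k → Represents k (dyadicG a k) a
  represents-dyadicG a k = subst₂ (λ N V → Represents N (dyadicG a k) V) (+-identityʳ k) (*-identityʳ a)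
    (represents-natMulG (represents-pow2neg k 0) a)

  represents-leftOnly∶natG : ∀ {N D A} → Represents N D A → A < 2 ^ N → ∀ n →
                             Represents N (leftOnly D ∶G natG n) (suc n * 2 ^ N)
  represents-leftOnly∶natG {N} {A = A} d A<2^N zero = num (λ { zero → d }) (λ ())
    (simplest-leftOnly (<-≤-trans A<2^N (m≤m+n _ 0)) (n∣m*n 1)
      (≤-trans (≤-reflexive (+-identityʳ _)) (m≤n+m _ A)))
  represents-leftOnly∶natG {N} {A = A} d A<2^N (suc n) =
    num {vl = vl} {vr = λ ()} (λ { zero → d ; (suc zero) → represents-leftOnly∶natG d A<2^N n }) (λ ()) record
    { below = λ { zero → <-≤-trans A<2^N (m≤m+n _ _) ; (suc zero) → m<n+m _ (m^n>0 2 N) }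
    ; above = λ ()
    ; grained = record
      { grain = N ; grain≤N = ≤-refl ; grain∣V = n∣m*n (suc (suc n))
      ; near-left = λ _ → suc zero , ≤-reflexive (+-comm (2 ^ N) _) ; near-right = ⊥-elim ∘ n≮n N } }
    where
    vl : Vector ℕ 2
    vl zero       = A
    vl (suc zero) = suc n * 2 ^ N

  leftOnly∶natG≈natG : ∀ {N D A} → Represents N D A → A < 2 ^ N → ∀ n →
                       leftOnly D ∶G natG n ≈G natG (n + 1)
  leftOnly∶natG≈natG {N} d A<2^N n =
    ≡⇒≈G (represents-leftOnly∶natG d A<2^N n) (represents-natG (n + 1)) (cong (_* 2 ^ N) (+-comm 1 n))

  shiftR≡/ : ∀ x b → shiftR x b ≡ _/_ x (2 ^ b) {{m^n≢0 2 b}}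
  shiftR≡/ x zero    = sym (n/1≡n x)
  shiftR≡/ x (suc b) =
    trans (shiftR≡/ (x / 2) b) (m/n/o≡m/[n*o] x 2 (2 ^ b) {{_}} {{m^n≢0 2 b}} {{m^n≢0 2 (suc b)}})

  shiftR-/2 : ∀ x b → shiftR x b / 2 ≡ shiftR (x / 2) b
  shiftR-/2 x zero    = refl
  shiftR-/2 x (suc b) = shiftR-/2 (x / 2) b

  module _ (x b : ℕ) where
    private instance
      2^b≢0 : NonZero (2 ^ b)
      2^b≢0 = m^n≢0 2 b

    shiftR-*-≤ : shiftR x b * 2 ^ b ≤ x
    shiftR-*-≤ = subst (λ q → q * 2 ^ b ≤ x) (sym (shiftR≡/ x b)) (m/n*n≤m x (2 ^ b))

    <-suc-shiftR-* : x < suc (shiftR x b) * 2 ^ b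
    <-suc-shiftR-* = subst (λ q → x < suc q * 2 ^ b) (sym (shiftR≡/ x b))
      (subst (_< 2 ^ b + x / 2 ^ b * 2 ^ b) (sym (m≡m%n+[m/n]*n x (2 ^ b)))
        (+-monoˡ-< (x / 2 ^ b * 2 ^ b) (m%n<n x (2 ^ b))))

  -- ⌊2^i d⌋ for d = a/2^k, so that d_1 … d_i are the binary digits of truncation a k i.
  truncation : ℕ → ℕ → ℕ → ℕ
  truncation a k i = shiftR (a * 2 ^ i) k

  truncation-zero : ∀ a k → a < 2 ^ k → truncation a k 0 ≡ 0
  truncation-zero a k a<2^k =
    trans (shiftR≡/ (a * 1) k) (m<n⇒m/n≡0 {{m^n≢0 2 k}} (subst (_< 2 ^ k) (sym (*-identityʳ a)) a<2^k))

  truncation-suc : ∀ a k i → truncation a k (suc i) ≡ digit a k (suc i) + 2 * truncation a k i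
  truncation-suc a k i = trans (m≡m%n+[m/n]*n (truncation a k (suc i)) 2)
    (cong (digit a k (suc i) +_) (trans (cong (_* 2) halve) (*-comm (truncation a k i) 2)))
    where
    *-comm-2 : ∀ a b → a * (2 * b) ≡ a * b * 2
    *-comm-2 = solve-∀
    halve : truncation a k (suc i) / 2 ≡ truncation a k i
    halve = begin
      shiftR (a * 2 ^ suc i) k / 2   ≡⟨ shiftR-/2 (a * 2 ^ suc i) k ⟩
      shiftR (a * 2 ^ suc i / 2) k   ≡⟨ cong (λ x → shiftR (x / 2) k) (*-comm-2 a (2 ^ i)) ⟩
      shiftR (a * 2 ^ i * 2 / 2) k   ≡⟨ cong (λ x → shiftR x k) (m*n/n≡m (a * 2 ^ i) 2) ⟩
      shiftR (a * 2 ^ i) k           ∎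
      where open ≡-Reasoning

  digit<2 : ∀ a k i → digit a k i < 2
  digit<2 a k i = m%n<n (truncation a k i) 2

  module _ {a k : ℕ} (a<2^k : a < 2 ^ k) where

    represents-leftOnly∶negG : ∀ i → Represents (i + k) (leftOnly (dyadicG a k) ∶G negG (zeroCount a k i))
                                                 (suc (truncation a k i) * 2 ^ k)
    represents-leftOnly∶negG zero =
      subst (λ t → Represents k (leftOnly (dyadicG a k) ∶G zeroG) (suc t * 2 ^ k))
        (sym (truncation-zero a k a<2^k))
        (represents-leftOnly∶natG (represents-dyadicG a k) a<2^k 0)
    represents-leftOnly∶negG (suc i) with digit a k (suc i) in dᵢ₊₁ | truncation-suc a k i
    ... | suc (suc _) | _ = ⊥-elim (n≮0 (s<s⁻¹ (s<s⁻¹ (subst (_< 2) dᵢ₊₁ (digit<2 a k (suc i))))))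
    ... | suc zero | Tᵢ₊₁ =
      subst (Represents _ _)
        (trans (double-suc (truncation a k i) (2 ^ k)) (cong (λ t → suc t * 2 ^ k) (sym Tᵢ₊₁)))
        (represents-double (represents-leftOnly∶negG i))
      where
      double-suc : ∀ t B → 2 * (suc t * B) ≡ suc (suc (2 * t)) * B
      double-suc = solve-∀
    ... | zero | Tᵢ₊₁ =
      num (λ { zero → represents-rescale (suc i) (represents-dyadicG a k) })
          (λ { zero → represents-double (represents-leftOnly∶negG i) })
        (simplest-between
          (<-suc-shiftR-* (a * 2 ^ suc i) k)
          (subst (V <_) (sym R≡V+2^k) (m<m+n V (m^n>0 2 k)))
          (m≤n+m k (suc i))
          (n∣m*n (suc (truncation a k (suc i))))
          (subst (V ≤_) (+-comm (2 ^ k) _) (+-monoʳ-≤ (2 ^ k) (shiftR-*-≤ (a * 2 ^ suc i) k)))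
          (≤-reflexive R≡V+2^k))
      where
      V = suc (truncation a k (suc i)) * 2 ^ k
      double-suc : ∀ t B → 2 * (suc t * B) ≡ suc (2 * t) * B + B
      double-suc = solve-∀
      R≡V+2^k : 2 * (suc (truncation a k i) * 2 ^ k) ≡ V + 2 ^ k
      R≡V+2^k = trans (double-suc (truncation a k i) (2 ^ k)) (cong (λ t → suc t * 2 ^ k + 2 ^ k) (sym Tᵢ₊₁))

    represents-prefixG : ∀ i → Represents (i + k) (prefixG a k i) (truncation a k i * 2 ^ k)
    represents-prefixG zero =
      subst (λ t → Represents k zeroG (t * 2 ^ k)) (sym (truncation-zero a k a<2^k)) represents-zeroG
    represents-prefixG (suc i) = subst (Represents _ _) value
      (represents-+ (represents-double (represents-prefixG i))
                    (represents-natMulG (represents-pow2neg (suc i) k) (digit a k (suc i))))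
      where
      distrib : ∀ t d B → 2 * (t * B) + d * B ≡ (d + 2 * t) * B
      distrib = solve-∀
      value : 2 * (truncation a k i * 2 ^ k) + digit a k (suc i) * 2 ^ k ≡ truncation a k (suc i) * 2 ^ k
      value = trans (distrib (truncation a k i) (digit a k (suc i)) (2 ^ k))
                    (cong (_* 2 ^ k) (sym (truncation-suc a k i)))

    leftOnly∶negG≈prefix+pow2neg : ∀ j → digit a k (suc j) ≡ 0 →
      leftOnly (dyadicG a k) ∶G negG (zeroCount a k (suc j)) ≈G prefixG a k j +G pow2neg (suc j)
    leftOnly∶negG≈prefix+pow2neg j dⱼ₊₁≡0 =
      ≡⇒≈G (represents-leftOnly∶negG (suc j))
           (represents-+ (represents-double (represents-prefixG j)) (represents-pow2neg (suc j) k))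
           (trans (cong (λ t → suc t * 2 ^ k) Tⱼ₊₁) (distrib (truncation a k j) (2 ^ k)))
      where
      Tⱼ₊₁ : truncation a k (suc j) ≡ 2 * truncation a k j
      Tⱼ₊₁ = trans (truncation-suc a k j) (cong (_+ 2 * truncation a k j) dⱼ₊₁≡0)
      distrib : ∀ t B → suc (2 * t) * B ≡ 2 * (t * B) + B
      distrib = solve-∀

  zeroCount-zero : ∀ j → zeroCount 0 0 j ≡ j
  zeroCount-zero zero    = refl
  zeroCount-zero (suc j) = cong suc (zeroCount-zero j)

  -- The case d = 0: every digit is 0, so the c-th zero digit is the c-th digit.
  leftOnly-zero∶negG≈pow2neg : ∀ c → leftOnly zeroG ∶G negG c ≈G pow2neg c
  leftOnly-zero∶negG≈pow2neg c =
    subst (λ c′ → leftOnly zeroG ∶G negG c′ ≈G pow2neg c) (zeroCount-zero c)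
    (≡⇒≈G (represents-leftOnly∶negG (s≤s z≤n) c) (represents-pow2neg c 0) refl)

open DyadicValues
open import Data.Integer using (ℤ; +_; -[1+_]; _+_; ∣_∣; +<+) renaming (_<_ to _<ℤ_)

corollary2p15 : (a k : ℕ) → a < 2 ^ k →
    ((m : ℤ) → + 0 <ℤ m → leftOnly (dyadicG a k) ∶G intG m ≈G intG (m + + 1))
    × ((m : ℤ) → m <ℤ + 0 → leftOnly zeroG ∶G intG m ≈G pow2neg ∣ m ∣)
    × ((m : ℤ) → m <ℤ + 0 → a ≢ 0 → (j : ℕ) → IsNthZeroIndex a k ∣ m ∣ j →
         leftOnly (dyadicG a k) ∶G intG m ≈G prefixG a k (j ∸ 1) +G pow2neg j)
corollary2p15 a k a<2^k =
  (λ { (+ zero) (+<+ ())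
     ; (+ suc n) _ → leftOnly∶natG≈natG (represents-dyadicG a k) a<2^k (suc n) }) ,
  (λ { (+ _) (+<+ ()) ; -[1+ n ] _ → leftOnly-zero∶negG≈pow2neg (suc n) }) ,
  (λ { (+ _) (+<+ ()) ; -[1+ n ] _ _ zero (() , _)
     ; -[1+ n ] _ _ (suc j) (_ , dⱼ₊₁≡0 , zeroCount≡n+1) →
         subst (λ c → leftOnly (dyadicG a k) ∶G negG c ≈G prefixG a k j +G pow2neg (suc j))
           zeroCount≡n+1
           (leftOnly∶negG≈prefix+pow2neg a<2^k j dⱼ₊₁≡0) })
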